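{- Let $G$ be a finite group and let $S$ be a simple self-dual $\mathbb{F}_2G$-module which carries a non-degenerate symmetric $G$-invariant bilinear form $\varphi:S\times S\to\mathbb{F}_2$. Then $\varphi$ is unique up to isometry: if $\psi$ is another non-degenerate symmetric $G$-invariant bilinear form on $S$, there is an $\mathbb{F}_2G$-automorphism $\gamma$ of $S$ with $\psi(s,s')=\varphi(\gamma(s),\gamma(s'))$ for all $s,s'\in S$.
   Context: For a right $\mathbb{F}_2G$-module $S$, the dual module is $S^*=\mathrm{Hom}_{\mathbb{F}_2}(S,\mathbb{F}_2)$ with $(fg)(s)=f(sg^{ -1})$; $S$ is self-dual if $S\cong S^*$. A bilinear form is $G$-invariant if $\varphi(sg,s'g)=\varphi(s,s')$ for all $g\in G$. -}

module Defs where

open import Level using (Level; _⊔_; suc) renaming (zero to lzero)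
open import Data.Bool using (Bool; true; false; _xor_)
open import Data.Nat using (ℕ)
open import Data.Fin using (Fin)
open import Data.Vec using (Vec; zipWith; replicate)
open import Data.Product using (Σ; ∃; _×_; _,_)
open import Data.Sum using (_⊎_)
open import Relation.Binary.PropositionalEquality using (_≡_)
open import Algebra.Bundles using (Group)

-- The field F₂ is Bool with xor as addition and ∧ as multiplication.
-- A finite-dimensional F₂-vector space of dimension n is F₂ⁿ = Vec Bool n.

Vec₂ : ℕ → Set
Vec₂ n = Vec Bool n

_⊕_ : ∀ {n} → Vec₂ n → Vec₂ n → Vec₂ n
_⊕_ = zipWith _xor_

𝟎 : ∀ {n} → Vec₂ n
𝟎 = replicate _ false

-- F₂-linearity (scalars are 0,1, so additivity suffices)
IsLinear : ∀ {n} → (Vec₂ n → Vec₂ n) → Set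
IsLinear f = ∀ x y → f (x ⊕ y) ≡ f x ⊕ f y

IsFunctional : ∀ {n} → (Vec₂ n → Bool) → Set
IsFunctional f = ∀ x y → f (x ⊕ y) ≡ f x xor f y

IsFiniteGroup : ∀ {c ℓ} → Group c ℓ → Set (c ⊔ ℓ)
IsFiniteGroup G = ∃ λ (m : ℕ) → Σ (Fin m → Carrier) λ e → ∀ g → ∃ λ i → e i ≈ g
  where open Group G

-- A right F₂G-module structure on F₂ⁿ: s ↦ s·g, written act g s.
record RightModule {c ℓ} (G : Group c ℓ) (n : ℕ) : Set (c ⊔ ℓ) where
  open Group G
  field
    act      : Carrier → Vec₂ n → Vec₂ n
    act-lin  : ∀ g → IsLinear (act g)
    act-cong : ∀ {g h} → g ≈ h → ∀ s → act g s ≡ act h s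
    act-ε    : ∀ s → act ε s ≡ s
    act-∙    : ∀ g h s → act (g ∙ h) s ≡ act h (act g s)

module _ {c ℓ} {G : Group c ℓ} {n : ℕ} (S : RightModule G n) where
  open Group G
  open RightModule S

  IsSubmodule : (Vec₂ n → Set) → Set c
  IsSubmodule P = P 𝟎 × (∀ x y → P x → P y → P (x ⊕ y)) × (∀ g x → P x → P (act g x))

  IsSimple : Set (suc lzero ⊔ c)
  IsSimple = (∃ λ (s : Vec₂ n) → s ≡ 𝟎 → Data.Empty.⊥)
           × (∀ P → IsSubmodule P → (∀ s → P s → s ≡ 𝟎) ⊎ (∀ s → P s))
    where import Data.Empty

  -- S ≅ S* as F₂G-modules, where S* = Hom(S,F₂) with (f·g)(s) = f(s·g⁻¹).
  -- θ : S → S* is F₂-linear, lands in linear functionals, is G-equivariant,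
  -- injective and surjective onto S*.
  IsSelfDual : Set c
  IsSelfDual = Σ (Vec₂ n → Vec₂ n → Bool) λ θ →
      (∀ s → IsFunctional (θ s))
    × (∀ s s' t → θ (s ⊕ s') t ≡ θ s t xor θ s' t)
    × (∀ g s t → θ (act g s) t ≡ θ s (act (g ⁻¹) t))
    × (∀ s s' → (∀ t → θ s t ≡ θ s' t) → s ≡ s')
    × (∀ f → IsFunctional f → ∃ λ s → ∀ t → θ s t ≡ f t)

  IsInvariantForm : (Vec₂ n → Vec₂ n → Bool) → Set c
  IsInvariantForm φ =
      (∀ s → IsFunctional (φ s))
    × (∀ s s' t → φ (s ⊕ s') t ≡ φ s t xor φ s' t)
    × (∀ s t → φ s t ≡ φ t s)
    × (∀ s → (∀ t → φ s t ≡ false) → s ≡ 𝟎)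
    × (∀ g s t → φ (act g s) (act g t) ≡ φ s t)

  IsAutomorphism : (Vec₂ n → Vec₂ n) → Set c
  IsAutomorphism γ =
      IsLinear γ
    × (∀ g s → γ (act g s) ≡ act g (γ s))
    × (∀ s s' → γ s ≡ γ s' → s ≡ s')
    × (∀ t → ∃ λ s → γ s ≡ t)

{-# OPTIONS --safe #-}
-- Since S ≅ S* and φ is non-degenerate, ψ(s,t) = φ(αs,t) for an equivariant, injective,
-- φ-self-adjoint endomorphism α of S. As S is finite, α has finite order. In characteristic 2 an
-- equivariant involution β of a simple module is trivial (s + βs is always β-fixed, so the fixed
-- submodule is nonzero unless β = 1), so halving shows that α has odd order 2k+1. Then γ = α^(k+1)
-- is an automorphism with γ² = α, and φ(γs,γt) = φ(γ²s,t) = φ(αs,t) = ψ(s,t).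
module Submission where

open import Defs
open import Level using (Level)
open import Data.Nat using (ℕ)
open import Data.Bool using (Bool)
open import Data.Product using (Σ; ∃; _×_; _,_)
open import Relation.Binary.PropositionalEquality using (_≡_)
open import Algebra.Bundles using (Group)

open import Data.Bool using (false; _xor_)
open import Data.Bool.Properties using (xor-same; xor-comm; xor-assoc; xor-identityʳ)
open import Data.Empty using (⊥-elim)
open import Data.Fin using (Fin; toℕ; funToFin; finToFun)
open import Data.Fin.Properties using (pigeonhole; finToFun-funToFin; 2↔Bool)
open import Data.Nat using (zero; suc; _+_; _∸_; _<_; z<s)
import Data.Nat as ℕ
open import Data.Nat.Induction using (<-rec)
open import Data.Nat.Properties using (+-suc; suc-injective; m+[n∸m]≡n; m<m+n; n<1+n)
open import Data.Product using (proj₁; proj₂)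
open import Data.Sum using (_⊎_; inj₁; inj₂)
open import Data.Vec using ([]; _∷_; lookup; tabulate)
open import Data.Vec.Properties using (zipWith-assoc; zipWith-comm; zipWith-identityʳ; tabulate-cong; tabulate∘lookup)
open import Function.Base using (id; _∘_)
open import Function.Bundles using (Inverse)
open import Function.Definitions using (Injective)
open import Relation.Binary.PropositionalEquality using (_≗_; refl; sym; trans; cong; cong₂; cong-app; subst; module ≡-Reasoning)

module _ {A : Set} where
  open import Function.Endo.Propositional A using (_^_)

  ^-closed : ∀ {ℓ} (P : (A → A) → Set ℓ) → P id → (∀ {g h} → P g → P h → P (g ∘ h)) →
             ∀ {f} → P f → ∀ k → P (f ^ k)
  ^-closed P P-id P-∘ Pf zero    = P-id
  ^-closed P P-id P-∘ Pf (suc k) = P-∘ Pf (^-closed P P-id P-∘ Pf k)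

  ^-injective : ∀ {f} → Injective _≡_ _≡_ f → ∀ k → Injective _≡_ _≡_ (f ^ k)
  ^-injective = ^-closed (Injective _≡_ _≡_) id (λ g-inj h-inj → h-inj ∘ g-inj)

  ^-commute : ∀ f k (x : A) → (f ^ k) (f x) ≡ f ((f ^ k) x)
  ^-commute f zero    x = refl
  ^-commute f (suc k) x = cong f (^-commute f k x)

  ^-selfAdjoint : ∀ {C : Set} (B : A → A → C) {f} → (∀ s t → B (f s) t ≡ B s (f t)) →
                  ∀ k s t → B ((f ^ k) s) t ≡ B s ((f ^ k) t)
  ^-selfAdjoint B         f-adj zero    s t = refl
  ^-selfAdjoint B {f} f-adj (suc k) s t = begin
    B (f ((f ^ k) s)) t     ≡⟨ f-adj _ t ⟩
    B ((f ^ k) s) (f t)     ≡⟨ ^-selfAdjoint B f-adj k s (f t) ⟩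
    B s ((f ^ k) (f t))     ≡⟨ cong (B s) (^-commute f k t) ⟩
    B s (f ((f ^ k) t))     ∎
    where open ≡-Reasoning

module FinitelyEncoded {A : Set} {N : ℕ} (encode : A → Fin N) (decode : Fin N → A)
                  (decode-encode : ∀ x → decode (encode x) ≡ x) where
  open import Function.Endo.Propositional A using (_^_; ^-homo)

  code : (A → A) → Fin (N ℕ.^ N)
  code f = funToFin (encode ∘ f ∘ decode)

  code-injective : ∀ {f g} → code f ≡ code g → f ≗ g
  code-injective {f} {g} eq x = begin
    f x                                  ≡⟨ cong f (decode-encode x) ⟨
    f (decode (encode x))                ≡⟨ decode-encode _ ⟨
    decode (encode (f (decode (encode x)))) ≡⟨ cong decode (onCodes (encode x)) ⟩
    decode (encode (g (decode (encode x)))) ≡⟨ decode-encode _ ⟩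
    g (decode (encode x))                ≡⟨ cong g (decode-encode x) ⟩
    g x                                  ∎
    where
    open ≡-Reasoning
    onCodes : ∀ i → encode (f (decode i)) ≡ encode (g (decode i))
    onCodes i = trans (sym (finToFun-funToFin (encode ∘ f ∘ decode) i))
                (trans (cong (λ c → finToFun c i) eq) (finToFun-funToFin (encode ∘ g ∘ decode) i))

  injective⇒periodic : ∀ {f} → Injective _≡_ _≡_ f → ∃ λ d → f ^ suc d ≗ id
  injective⇒periodic {f} f-inj with pigeonhole (n<1+n (N ℕ.^ N)) (λ i → code (f ^ toℕ i))
  ... | i , j , i<j , eq = d , λ x → ^-injective f-inj (toℕ i) (begin
    (f ^ toℕ i) ((f ^ suc d) x)  ≡⟨ cong-app (^-homo f (toℕ i) (suc d)) x ⟨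
    (f ^ (toℕ i + suc d)) x      ≡⟨ cong (λ k → (f ^ k) x) i+[1+d]≡j ⟩
    (f ^ toℕ j) x                ≡⟨ code-injective eq x ⟨
    (f ^ toℕ i) x                ∎)
    where
    open ≡-Reasoning
    d = toℕ j ∸ suc (toℕ i)
    i+[1+d]≡j : toℕ i + suc d ≡ toℕ j
    i+[1+d]≡j = trans (+-suc (toℕ i) d) (m+[n∸m]≡n i<j)

⊕-self : ∀ {n} (x : Vec₂ n) → x ⊕ x ≡ 𝟎
⊕-self []      = refl
⊕-self (a ∷ x) = cong₂ _∷_ (xor-same a) (⊕-self x)

module _ {n : ℕ} where

  ⊕-assoc : (x y z : Vec₂ n) → (x ⊕ y) ⊕ z ≡ x ⊕ (y ⊕ z)
  ⊕-assoc = zipWith-assoc xor-assoc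

  ⊕-comm : (x y : Vec₂ n) → x ⊕ y ≡ y ⊕ x
  ⊕-comm = zipWith-comm xor-comm

  ⊕-identityʳ : (x : Vec₂ n) → x ⊕ 𝟎 ≡ x
  ⊕-identityʳ = zipWith-identityʳ xor-identityʳ

  ⊕≡𝟎⇒≡ : ∀ {x y : Vec₂ n} → x ⊕ y ≡ 𝟎 → x ≡ y
  ⊕≡𝟎⇒≡ {x} {y} x⊕y≡𝟎 = begin
    x             ≡⟨ ⊕-identityʳ x ⟨
    x ⊕ 𝟎         ≡⟨ cong (x ⊕_) (⊕-self y) ⟨
    x ⊕ (y ⊕ y)   ≡⟨ ⊕-assoc x y y ⟨
    (x ⊕ y) ⊕ y   ≡⟨ cong (_⊕ y) x⊕y≡𝟎 ⟩
    𝟎 ⊕ y         ≡⟨ ⊕-comm 𝟎 y ⟩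
    y ⊕ 𝟎         ≡⟨ ⊕-identityʳ y ⟩
    y             ∎
    where open ≡-Reasoning

  linear-𝟎 : ∀ {f : Vec₂ n → Vec₂ n} → IsLinear f → f 𝟎 ≡ 𝟎
  linear-𝟎 {f} f-lin = begin
    f 𝟎           ≡⟨ cong f (⊕-self 𝟎) ⟨
    f (𝟎 ⊕ 𝟎)     ≡⟨ f-lin 𝟎 𝟎 ⟩
    f 𝟎 ⊕ f 𝟎     ≡⟨ ⊕-self (f 𝟎) ⟩
    𝟎             ∎
    where open ≡-Reasoning

  encode : Vec₂ n → Fin (2 ℕ.^ n)
  encode v = funToFin (Inverse.from 2↔Bool ∘ lookup v)

  decode : Fin (2 ℕ.^ n) → Vec₂ n
  decode i = tabulate (Inverse.to 2↔Bool ∘ finToFun i)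

  decode-encode : ∀ v → decode (encode v) ≡ v
  decode-encode v = trans (tabulate-cong λ j →
      trans (cong (Inverse.to 2↔Bool) (finToFun-funToFin _ j)) (Inverse.strictlyInverseˡ 2↔Bool (lookup v j)))
    (tabulate∘lookup v)

  open FinitelyEncoded encode decode decode-encode public using (injective⇒periodic)

even-or-odd : ∀ m → (∃ λ k → m ≡ k + k) ⊎ (∃ λ k → m ≡ suc (k + k))
even-or-odd zero = inj₁ (0 , refl)
even-or-odd (suc m) with even-or-odd m
... | inj₁ (k , m≡k+k)     = inj₂ (k , cong suc m≡k+k)
... | inj₂ (k , m≡1+k+k)   = inj₁ (suc k , trans (cong suc m≡1+k+k) (cong suc (sym (+-suc k k))))

module _ {c ℓ} {G : Group c ℓ} {n : ℕ} (S : RightModule G n) where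
  open Group G using (_⁻¹; inverseˡ)
  open RightModule S
  open import Function.Endo.Propositional (Vec₂ n) using (_^_; ^-homo)

  act-act⁻¹ : ∀ g t → act g (act (g ⁻¹) t) ≡ t
  act-act⁻¹ g t = trans (sym (act-∙ (g ⁻¹) g t)) (trans (act-cong (inverseˡ g) t) (act-ε t))

  record IsEndomorphism (f : Vec₂ n → Vec₂ n) : Set c where
    field
      linear      : IsLinear f
      equivariant : ∀ g s → f (act g s) ≡ act g (f s)

  ^-isEndomorphism : ∀ {f} → IsEndomorphism f → ∀ k → IsEndomorphism (f ^ k)
  ^-isEndomorphism = ^-closed IsEndomorphism id-isEndomorphism ∘-isEndomorphism
    where
    id-isEndomorphism : IsEndomorphism id
    id-isEndomorphism = record { linear = λ _ _ → refl ; equivariant = λ _ _ → refl }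
    ∘-isEndomorphism : ∀ {g h} → IsEndomorphism g → IsEndomorphism h → IsEndomorphism (g ∘ h)
    ∘-isEndomorphism {g} gᴱ hᴱ = record
      { linear      = λ x y → trans (cong g (H.linear x y)) (G.linear _ _)
      ; equivariant = λ a s → trans (cong g (H.equivariant a s)) (G.equivariant a _)
      }
      where
      module G = IsEndomorphism gᴱ
      module H = IsEndomorphism hᴱ

  Separating : (Vec₂ n → Vec₂ n → Bool) → Set
  Separating B = ∀ {u v} → (∀ t → B u t ≡ B v t) → u ≡ v

  record IsPairing (B : Vec₂ n → Vec₂ n → Bool) : Set c where
    field
      linearˡ       : ∀ s s' t → B (s ⊕ s') t ≡ B s t xor B s' t
      act-transpose : ∀ g s t → B (act g s) t ≡ B s (act (g ⁻¹) t)

  module InvariantForm {B : Vec₂ n → Vec₂ n → Bool} (Bᴵ : IsInvariantForm S B) where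
    linearʳ : ∀ s → IsFunctional (B s)
    linearʳ = proj₁ Bᴵ

    linearˡ : ∀ s s' t → B (s ⊕ s') t ≡ B s t xor B s' t
    linearˡ = proj₁ (proj₂ Bᴵ)

    symmetric : ∀ s t → B s t ≡ B t s
    symmetric = proj₁ (proj₂ (proj₂ Bᴵ))

    nondegenerate : ∀ s → (∀ t → B s t ≡ false) → s ≡ 𝟎
    nondegenerate = proj₁ (proj₂ (proj₂ (proj₂ Bᴵ)))

    invariant : ∀ g s t → B (act g s) (act g t) ≡ B s t
    invariant = proj₂ (proj₂ (proj₂ (proj₂ Bᴵ)))

    isPairing : IsPairing B
    isPairing = record
      { linearˡ       = linearˡ
      ; act-transpose = λ g s t →
          trans (cong (B (act g s)) (sym (act-act⁻¹ g t))) (invariant g s (act (g ⁻¹) t))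
      }

    separating : Separating B
    separating {u} {v} B-agree = ⊕≡𝟎⇒≡ (nondegenerate (u ⊕ v) λ t →
      trans (linearˡ u v t) (trans (cong (_xor B v t) (B-agree t)) (xor-same (B v t))))

  module _ {P B : Vec₂ n → Vec₂ n → Bool} {α : Vec₂ n → Vec₂ n}
           (α-represents : ∀ s t → P (α s) t ≡ B s t) where

    representative-isEndomorphism : IsPairing P → Separating P → IsPairing B → IsEndomorphism α
    representative-isEndomorphism Pᴾ P-separating Bᴾ = record
      { linear      = λ s s' → P-separating λ t → begin
          P (α (s ⊕ s')) t            ≡⟨ α-represents (s ⊕ s') t ⟩
          B (s ⊕ s') t                ≡⟨ B.linearˡ s s' t ⟩
          B s t xor B s' t            ≡⟨ cong₂ _xor_ (α-represents s t) (α-represents s' t) ⟨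
          P (α s) t xor P (α s') t    ≡⟨ P.linearˡ (α s) (α s') t ⟨
          P (α s ⊕ α s') t            ∎
      ; equivariant = λ g s → P-separating λ t → begin
          P (α (act g s)) t           ≡⟨ α-represents (act g s) t ⟩
          B (act g s) t               ≡⟨ B.act-transpose g s t ⟩
          B s (act (g ⁻¹) t)          ≡⟨ α-represents s (act (g ⁻¹) t) ⟨
          P (α s) (act (g ⁻¹) t)      ≡⟨ P.act-transpose g (α s) t ⟨
          P (act g (α s)) t           ∎
      }
      where
      open ≡-Reasoning
      module P = IsPairing Pᴾ
      module B = IsPairing Bᴾ

    representative-injective : Separating B → Injective _≡_ _≡_ α
    representative-injective B-separating αs≡αs' = B-separating λ t →
      trans (sym (α-represents _ t)) (trans (cong (λ a → P a t) αs≡αs') (α-represents _ t))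

    representative-selfAdjoint : (∀ s t → P s t ≡ P t s) → (∀ s t → B s t ≡ B t s) →
                                 ∀ s t → P (α s) t ≡ P s (α t)
    representative-selfAdjoint P-symmetric B-symmetric s t = begin
      P (α s) t    ≡⟨ α-represents s t ⟩
      B s t        ≡⟨ B-symmetric s t ⟩
      B t s        ≡⟨ α-represents t s ⟨
      P (α t) s    ≡⟨ P-symmetric (α t) s ⟩
      P s (α t)    ∎
      where open ≡-Reasoning

  module _ (simple : IsSimple S) where
    private
      dichotomy : ∀ P → IsSubmodule S P → (∀ s → P s → s ≡ 𝟎) ⊎ (∀ s → P s)
      dichotomy = proj₂ simple

    injective⇒surjective : ∀ {f} → IsEndomorphism f → Injective _≡_ _≡_ f →
                           ∀ t → ∃ λ s → f s ≡ t
    injective⇒surjective {f} fᴱ f-inj with dichotomy (λ t → ∃ λ s → f s ≡ t) image-isSubmodule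
      where
      open IsEndomorphism fᴱ
      image-isSubmodule : IsSubmodule S (λ t → ∃ λ s → f s ≡ t)
      image-isSubmodule = (𝟎 , linear-𝟎 linear)
        , (λ { _ _ (u , refl) (v , refl) → u ⊕ v , linear u v })
        , (λ { g _ (u , refl) → act g u , equivariant g u })
    ... | inj₂ everything = everything
    ... | inj₁ onlyZero   = let s , s≢𝟎 = proj₁ simple in
      ⊥-elim (s≢𝟎 (f-inj (trans (onlyZero (f s) (s , refl))
                                (sym (linear-𝟎 (IsEndomorphism.linear fᴱ))))))

    involution⇒id : ∀ {β} → IsEndomorphism β → (∀ s → β (β s) ≡ s) → ∀ s → β s ≡ s
    involution⇒id {β} βᴱ β²≡id s with dichotomy (λ t → β t ≡ t) fixed-isSubmodule
      where
      open IsEndomorphism βᴱ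
      fixed-isSubmodule : IsSubmodule S (λ t → β t ≡ t)
      fixed-isSubmodule = linear-𝟎 linear
        , (λ x y βx≡x βy≡y → trans (linear x y) (cong₂ _⊕_ βx≡x βy≡y))
        , (λ g x βx≡x → trans (equivariant g x) (cong (act g) βx≡x))
    ... | inj₂ allFixed = allFixed s
    ... | inj₁ onlyZero = sym (⊕≡𝟎⇒≡ (onlyZero (s ⊕ β s) s⊕βs-fixed))
      where
      s⊕βs-fixed : β (s ⊕ β s) ≡ s ⊕ β s
      s⊕βs-fixed = trans (IsEndomorphism.linear βᴱ s (β s))
                         (trans (cong (β s ⊕_) (β²≡id s)) (⊕-comm (β s) s))

    odd-order : ∀ {f} → IsEndomorphism f → ∀ p → f ^ suc p ≗ id → ∃ λ k → f ^ suc (k + k) ≗ id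
    odd-order {f} fᴱ = <-rec _ step
      where
      step : ∀ p → (∀ {m} → m < p → f ^ suc m ≗ id → ∃ λ k → f ^ suc (k + k) ≗ id) →
             f ^ suc p ≗ id → ∃ λ k → f ^ suc (k + k) ≗ id
      step p recurse periodic with even-or-odd (suc p)
      ... | inj₂ (k , 1+p≡1+2k) = k , λ x → trans (cong (λ e → (f ^ e) x) (sym 1+p≡1+2k)) (periodic x)
      ... | inj₁ (zero , ())
      ... | inj₁ (suc m , 1+p≡2[1+m]) = recurse m<p (involution⇒id (^-isEndomorphism fᴱ (suc m)) square)
        where
        square : ∀ x → (f ^ suc m) ((f ^ suc m) x) ≡ x
        square x = trans (sym (cong-app (^-homo f (suc m) (suc m)) x))
                   (trans (cong (λ e → (f ^ e) x) (sym 1+p≡2[1+m])) (periodic x))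
        m<p : m < p
        m<p = subst (m <_) (sym (suc-injective 1+p≡2[1+m])) (m<m+n m z<s)

    representable : IsSelfDual S → ∀ {φ} → IsInvariantForm S φ →
                    ∀ f → IsFunctional f → ∃ λ b → ∀ t → φ b t ≡ f t
    representable (θ , _ , θ-linearˡ , θ-transpose , θ-separating , θ-onto) {φ} φᴵ f f-functional =
      let a , θa≡f  = θ-onto f f-functional
          b , φ♭b≡a = φ♭-onto a
      in  b , λ t → begin
            φ b t        ≡⟨ φ♭-represents b t ⟨
            θ (φ♭ b) t   ≡⟨ cong (λ x → θ x t) φ♭b≡a ⟩
            θ a t        ≡⟨ θa≡f t ⟩
            f t          ∎
      where
      open ≡-Reasoning
      module Φ = InvariantForm φᴵ

      φ♭ : Vec₂ n → Vec₂ n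
      φ♭ s = proj₁ (θ-onto (φ s) (Φ.linearʳ s))

      φ♭-represents : ∀ s t → θ (φ♭ s) t ≡ φ s t
      φ♭-represents s = proj₂ (θ-onto (φ s) (Φ.linearʳ s))

      θ-isPairing : IsPairing θ
      θ-isPairing = record { linearˡ = θ-linearˡ ; act-transpose = θ-transpose }

      φ♭-onto : ∀ a → ∃ λ b → φ♭ b ≡ a
      φ♭-onto = injective⇒surjective
        (representative-isEndomorphism φ♭-represents θ-isPairing (λ {u} {v} → θ-separating u v) Φ.isPairing)
        (representative-injective {P = θ} φ♭-represents Φ.separating)

    squareRoot-of-oddOrder : ∀ (φ : Vec₂ n → Vec₂ n → Bool) {α} → IsEndomorphism α →
      (∀ s t → φ (α s) t ≡ φ s (α t)) → ∀ k → α ^ suc (k + k) ≗ id →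
      Σ (Vec₂ n → Vec₂ n) λ γ → IsAutomorphism S γ × (∀ s t → φ (α s) t ≡ φ (γ s) (γ t))
    squareRoot-of-oddOrder φ {α} αᴱ α-selfAdjoint k α^[1+2k]≗id =
      γ , (linear , equivariant , (λ _ _ → γ-injective) , γ-onto) , γ-isometry
      where
      open IsEndomorphism (^-isEndomorphism αᴱ (suc k))

      γ : Vec₂ n → Vec₂ n
      γ = α ^ suc k

      γ∘α^k≗id : ∀ t → γ ((α ^ k) t) ≡ t
      γ∘α^k≗id t = trans (sym (cong-app (^-homo α (suc k) k) t)) (α^[1+2k]≗id t)

      α^k∘γ≗id : ∀ t → (α ^ k) (γ t) ≡ t
      α^k∘γ≗id t = trans (sym (cong-app (^-homo α k (suc k)) t))
                         (trans (cong (λ e → (α ^ e) t) (+-suc k k)) (α^[1+2k]≗id t))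

      γ-injective : Injective _≡_ _≡_ γ
      γ-injective {s} {s'} γs≡γs' =
        trans (sym (α^k∘γ≗id s)) (trans (cong (α ^ k) γs≡γs') (α^k∘γ≗id s'))

      γ-onto : ∀ t → ∃ λ s → γ s ≡ t
      γ-onto t = (α ^ k) t , γ∘α^k≗id t

      γ²≗α : ∀ s → γ (γ s) ≡ α s
      γ²≗α s = cong α (α^k∘γ≗id s)

      γ-isometry : ∀ s t → φ (α s) t ≡ φ (γ s) (γ t)
      γ-isometry s t = begin
        φ (α s) t          ≡⟨ cong (λ a → φ a t) (γ²≗α s) ⟨
        φ (γ (γ s)) t      ≡⟨ ^-selfAdjoint φ α-selfAdjoint (suc k) (γ s) t ⟩
        φ (γ s) (γ t)      ∎
        where open ≡-Reasoning

    selfAdjoint-squareRoot : ∀ (φ : Vec₂ n → Vec₂ n → Bool) {α} → IsEndomorphism α →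
      Injective _≡_ _≡_ α → (∀ s t → φ (α s) t ≡ φ s (α t)) →
      Σ (Vec₂ n → Vec₂ n) λ γ → IsAutomorphism S γ × (∀ s t → φ (α s) t ≡ φ (γ s) (γ t))
    selfAdjoint-squareRoot φ {α} αᴱ α-injective α-selfAdjoint =
      let d , α^[1+d]≗id  = injective⇒periodic α-injective
          k , α^[1+2k]≗id = odd-order αᴱ d α^[1+d]≗id
      in  squareRoot-of-oddOrder φ αᴱ α-selfAdjoint k α^[1+2k]≗id

lemma2p4 : ∀ {c ℓ} (G : Group c ℓ) → IsFiniteGroup G →
    (n : ℕ) (S : RightModule G n) → IsSimple S → IsSelfDual S →
    (φ ψ : Vec₂ n → Vec₂ n → Bool) → IsInvariantForm S φ → IsInvariantForm S ψ →
    Σ (Vec₂ n → Vec₂ n) λ γ → IsAutomorphism S γ × (∀ s t → ψ s t ≡ φ (γ s) (γ t))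
lemma2p4 G _ n S simple selfDual φ ψ φᴵ ψᴵ =
  let γ , γ-automorphism , γ-isometry = selfAdjoint-squareRoot S simple φ αᴱ α-injective α-selfAdjoint
  in  γ , γ-automorphism , λ s t → trans (sym (α-represents s t)) (γ-isometry s t)
  where
  module Φ = InvariantForm S φᴵ
  module Ψ = InvariantForm S ψᴵ

  α : Vec₂ n → Vec₂ n
  α s = proj₁ (representable S simple selfDual φᴵ (ψ s) (Ψ.linearʳ s))

  α-represents : ∀ s t → φ (α s) t ≡ ψ s t
  α-represents s = proj₂ (representable S simple selfDual φᴵ (ψ s) (Ψ.linearʳ s))

  αᴱ : IsEndomorphism S α
  αᴱ = representative-isEndomorphism S {P = φ} α-represents Φ.isPairing Φ.separating Ψ.isPairing

  α-injective : Injective _≡_ _≡_ α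
  α-injective = representative-injective S {P = φ} α-represents Ψ.separating

  α-selfAdjoint : ∀ s t → φ (α s) t ≡ φ s (α t)
  α-selfAdjoint = representative-selfAdjoint S {P = φ} α-represents Φ.symmetric Ψ.symmetric
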